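{- For integers $k\ge 1$ and $m\ge 0$ let \[ \mathcal{S}_{m}^{(k)}(1)=\sum_{q=0}^{k-1}\binom{2k}{q}(k-q)^m, \] with $\mathcal{S}_{m}^{(0)}(1)=0$ (empty sum). Then for all $k\ge 1$ and $m\ge 0$, \[ \mathcal{S}_{m+2}^{(k)}(1)=k^2\mathcal{S}_{m}^{(k)}(1)-2k(2k-1)\mathcal{S}_{m}^{(k-1)}(1). \]
   Context: $\mathcal{S}_{m}^{(k)}(1)$ is the value at $n=1$ of the binomial sum $\mathcal S^{(k)}_m(n)=\sum_{q=0}^{k-1}\binom{k(n+1)}{q}S^{(k-q)}_m(n)$, where $S^{(j)}_m(n)$ are defined by $\big(\sum_{p=1}^n e^{pt}\big)^j=\sum_{m\ge0}S^{(j)}_m(n)t^m/m!$; since $S^{(j)}_m(1)=j^m$, it equals the explicit sum given in the claim. -}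

module Defs where

open import Data.Nat using (ℕ; zero; suc; _+_; _*_; _∸_; _^_)
open import Data.Nat.Combinatorics using (_C_)

sumBelow : ℕ → (ℕ → ℕ) → ℕ
sumBelow zero    f = 0
sumBelow (suc n) f = sumBelow n f + f n

calS : ℕ → ℕ → ℕ
calS k m = sumBelow k (λ q → ((2 * k) C q) * ((k ∸ q) ^ m))

module Submission where

-- Put K = k + 1 and write calS K m = Σ_{q ≤ k} C(2K,q)·(K - q)^m.
-- The q = 0 term of calS K (m+2) is K²·K^m, i.e. K² times the q = 0 term of
-- calS K m.  For q < k the (q+1)-st term of calS K (m+2) and the q-th term of
-- 2K(2K-1)·calS k m share the factor j^m with j = k - q, and
--      C(2K,q+1)·j² + 2K(2K-1)·C(2k,q) = K²·C(2K,q+1),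
-- because K² - j² = (q+1)(2k+1-q) and the "double absorption" identity
--      (q+1)(r+1)·C(q+r+2,q+1) = (q+r+2)(q+r+1)·C(q+r,q)      (here q+r = 2k).
-- Summing these termwise identities gives, in ℕ,
--      calS K (m+2) + 2K(2K-1)·calS k m = K²·calS K m,
-- from which the stated subtraction in ℤ follows.

open import Defs
open import Data.Nat using (ℕ; suc; _+_; _*_; _∸_; _^_)
open import Data.Integer using (ℤ; +_; _-_)
open import Relation.Binary.PropositionalEquality using (_≡_)

open import Data.Nat using (zero; _<_; z≤n; s≤s)
open import Data.Nat.Properties
  using (+-suc; +-identityʳ; *-identityʳ; *-assoc; *-zeroʳ; *-distribˡ-+; m≤m+n; m+n∸m≡n; m+n∸n≡m; m≤n+m; m∸n+n≡m; <⇒≤; m<n⇒m<1+n; n<1+n; ^-distribˡ-+-*)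
open import Data.Nat.Combinatorics using (_C_; k>n⇒nCk≡0; nC1≡n; nCk≡nC[n∸k]; nCk+nC[k+1]≡[n+1]C[k+1])
open import Data.Nat.Tactic.RingSolver using (solve-∀)
open import Data.Integer using (_⊖_)
import Data.Integer.Properties as ℤP
open import Relation.Binary.PropositionalEquality using (refl; sym; trans; cong; cong₂)
open Relation.Binary.PropositionalEquality.≡-Reasoning

sumBelow-combine : ∀ n c d (f g h : ℕ → ℕ) →
  f 0 ≡ c * h 0 →
  (∀ q → q < n → f (suc q) + d * g q ≡ c * h (suc q)) →
  sumBelow (suc n) f + d * sumBelow n g ≡ c * sumBelow (suc n) h
sumBelow-combine zero c d f g h first _ = begin
  0 + f 0 + d * 0 ≡⟨ cong (λ x → f 0 + x) (*-zeroʳ d) ⟩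
  f 0 + 0         ≡⟨ cong (_+ 0) first ⟩
  c * h 0 + 0     ≡⟨ lemma c (h 0) ⟩
  c * (0 + h 0)   ∎
  where
  lemma : ∀ c x → c * x + 0 ≡ c * (0 + x)
  lemma = solve-∀
sumBelow-combine (suc n) c d f g h first later = begin
  (F + f (suc n)) + d * (G + g n)      ≡⟨ regroup F (f (suc n)) d G (g n) ⟩
  (F + d * G) + (f (suc n) + d * g n)
    ≡⟨ cong₂ _+_ (sumBelow-combine n c d f g h first (λ q q<n → later q (m<n⇒m<1+n q<n)))
                 (later n (n<1+n n)) ⟩
  c * H + c * h (suc n)                ≡⟨ *-distribˡ-+ c H (h (suc n)) ⟨
  c * (H + h (suc n))                  ∎
  where
  F = sumBelow (suc n) f
  G = sumBelow n g
  H = sumBelow (suc n) h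
  regroup : ∀ F a d G b → (F + a) + d * (G + b) ≡ (F + d * G) + (a + d * b)
  regroup = solve-∀

absorption : ∀ n k → suc k * (suc n C suc k) ≡ suc n * (n C k)
absorption n zero = trans (+-identityʳ (suc n C 1)) (trans (nC1≡n (suc n)) (sym (*-identityʳ (suc n))))
absorption zero (suc k) = begin
  suc (suc k) * (1 C suc (suc k)) ≡⟨ cong (suc (suc k) *_) (k>n⇒nCk≡0 {1} {suc (suc k)} (s≤s (s≤s z≤n))) ⟩
  suc (suc k) * 0                 ≡⟨ *-zeroʳ (suc (suc k)) ⟩
  0                               ≡⟨ cong (1 *_) (k>n⇒nCk≡0 {0} {suc k} (s≤s z≤n)) ⟨
  1 * (0 C suc k)                 ∎
absorption (suc n) (suc k) = begin
  suc (suc k) * (suc (suc n) C suc (suc k))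
    ≡⟨ cong (suc (suc k) *_) (nCk+nC[k+1]≡[n+1]C[k+1] (suc n) (suc k)) ⟨
  suc (suc k) * (A + B)              ≡⟨ expand k A B ⟩
  suc k * A + suc (suc k) * B + A    ≡⟨ cong (_+ A) (cong₂ _+_ (absorption n k) (absorption n (suc k))) ⟩
  suc n * (n C k) + suc n * (n C suc k) + A
    ≡⟨ cong (_+ A) (*-distribˡ-+ (suc n) (n C k) (n C suc k)) ⟨
  suc n * (n C k + n C suc k) + A    ≡⟨ cong (λ x → suc n * x + A) (nCk+nC[k+1]≡[n+1]C[k+1] n k) ⟩
  suc n * A + A                      ≡⟨ collect n A ⟩
  suc (suc n) * A                    ∎
  where
  A = suc n C suc k
  B = suc n C suc (suc k)
  expand : ∀ k A B → suc (suc k) * (A + B) ≡ suc k * A + suc (suc k) * B + A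
  expand = solve-∀
  collect : ∀ n A → suc n * A + A ≡ suc (suc n) * A
  collect = solve-∀

-- Symmetry written without truncated subtraction:  C(q+r,q) = C(q+r,r).
binomial-symmetry : ∀ q r → (q + r) C q ≡ (q + r) C r
binomial-symmetry q r = trans (nCk≡nC[n∸k] (m≤m+n q r)) (cong ((q + r) C_) (m+n∸m≡n q r))

-- Absorption from the other side:  (r+1)·C(q+r+1,q) = (q+r+1)·C(q+r,q);
-- by symmetry it is absorption at the complementary index r.
co-absorption : ∀ q r → suc r * (suc (q + r) C q) ≡ suc (q + r) * ((q + r) C q)
co-absorption q r = begin
  suc r * (suc (q + r) C q)     ≡⟨ cong (λ n → suc r * (n C q)) (+-suc q r) ⟨
  suc r * ((q + suc r) C q)     ≡⟨ cong (suc r *_) (binomial-symmetry q (suc r)) ⟩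
  suc r * ((q + suc r) C suc r) ≡⟨ cong (λ n → suc r * (n C suc r)) (+-suc q r) ⟩
  suc r * (suc (q + r) C suc r) ≡⟨ absorption (q + r) r ⟩
  suc (q + r) * ((q + r) C r)   ≡⟨ cong (suc (q + r) *_) (binomial-symmetry q r) ⟨
  suc (q + r) * ((q + r) C q)   ∎

-- Double absorption:  (q+1)(r+1)·C(q+r+2,q+1) = (q+r+2)(q+r+1)·C(q+r,q),
-- absorbing first at the top index q+r+2 and then at q+r+1.
double-absorption : ∀ q r →
  suc q * suc r * (suc (suc (q + r)) C suc q) ≡ suc (suc (q + r)) * suc (q + r) * ((q + r) C q)
double-absorption q r = begin
  suc q * suc r * (N₂ C suc q)      ≡⟨ swap (suc q) (suc r) (N₂ C suc q) ⟩
  suc r * (suc q * (N₂ C suc q))    ≡⟨ cong (suc r *_) (absorption (suc (q + r)) q) ⟩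
  suc r * (N₂ * (suc (q + r) C q))  ≡⟨ swap′ (suc r) N₂ (suc (q + r) C q) ⟩
  N₂ * (suc r * (suc (q + r) C q))  ≡⟨ cong (N₂ *_) (co-absorption q r) ⟩
  N₂ * (suc (q + r) * ((q + r) C q)) ≡⟨ *-assoc N₂ (suc (q + r)) ((q + r) C q) ⟨
  N₂ * suc (q + r) * ((q + r) C q)  ∎
  where
  N₂ = suc (suc (q + r))
  swap : ∀ a b x → a * b * x ≡ b * (a * x)
  swap = solve-∀
  swap′ : ∀ a b x → a * (b * x) ≡ b * (a * x)
  swap′ = solve-∀

-- The termwise identity behind the recursion (with K = k+1 and k = j+q):
--   C(2K,q+1)·j² + 2K(2K-1)·C(2k,q) = K²·C(2K,q+1),
-- i.e. double absorption with r = 2k - q, since K² - j² = (q+1)(r+1).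
squared-difference : ∀ k j q → j + q ≡ k →
  ((2 * suc k) C suc q) * (j * j) + 2 * suc k * (2 * suc k ∸ 1) * ((2 * k) C q)
    ≡ suc k ^ 2 * ((2 * suc k) C suc q)
squared-difference .(j + q) j q refl = begin
  ((2 * K) C suc q) * (j * j) + 2 * K * (2 * K ∸ 1) * ((2 * (j + q)) C q)
    ≡⟨ cong₂ (λ a b → (a C suc q) * (j * j) + a * (a ∸ 1) * (b C q))
             (top-index j q) (bottom-index j q) ⟩
  X * (j * j) + suc (suc (q + r)) * suc (q + r) * ((q + r) C q)
    ≡⟨ cong (λ y → X * (j * j) + y) (double-absorption q r) ⟨
  X * (j * j) + suc q * suc r * X ≡⟨ square-expansion j q X ⟩
  K ^ 2 * X                       ≡⟨ cong (λ a → K ^ 2 * (a C suc q)) (top-index j q) ⟨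
  K ^ 2 * ((2 * K) C suc q)       ∎
  where
  K = suc (j + q)
  r = j + (j + q)
  X = suc (suc (q + r)) C suc q
  top-index : ∀ j q → 2 * suc (j + q) ≡ suc (suc (q + (j + (j + q))))
  top-index = solve-∀
  bottom-index : ∀ j q → 2 * (j + q) ≡ q + (j + (j + q))
  bottom-index = solve-∀
  -- (j+q+1)² = j² + (q+1)(2j+q+1); the square is unfolded for the solver
  square-expansion : ∀ j q x →
    x * (j * j) + suc q * suc (j + (j + q)) * x ≡ suc (j + q) * (suc (j + q) * 1) * x
  square-expansion = solve-∀

summand : ℕ → ℕ → ℕ → ℕ
summand K m q = ((2 * K) C q) * ((K ∸ q) ^ m)

power-shift : ∀ a x m → a * x ^ (m + 2) ≡ x ^ 2 * (a * x ^ m)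
power-shift a x m = begin
  a * x ^ (m + 2)     ≡⟨ cong (a *_) (^-distribˡ-+-* x m 2) ⟩
  a * (x ^ m * x ^ 2) ≡⟨ rearrange a (x ^ m) (x ^ 2) ⟩
  x ^ 2 * (a * x ^ m) ∎
  where
  rearrange : ∀ a p s → a * (p * s) ≡ s * (a * p)
  rearrange = solve-∀

termwise : ∀ k m q → q < k →
  summand (suc k) (m + 2) (suc q) + 2 * suc k * (2 * suc k ∸ 1) * summand k m q
    ≡ suc k ^ 2 * summand (suc k) m (suc q)
termwise k m q q<k = begin
  A * j ^ (m + 2) + c * (B * p)   ≡⟨ cong (λ y → A * y + c * (B * p)) (^-distribˡ-+-* j m 2) ⟩
  A * (p * j ^ 2) + c * (B * p)   ≡⟨ factor A j p c B ⟩
  (A * (j * j) + c * B) * p       ≡⟨ cong (_* p) (squared-difference k j q (m∸n+n≡m (<⇒≤ q<k))) ⟩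
  suc k ^ 2 * A * p               ≡⟨ *-assoc (suc k ^ 2) A p ⟩
  suc k ^ 2 * (A * p)             ∎
  where
  j = k ∸ q
  p = j ^ m
  A = (2 * suc k) C suc q
  B = (2 * k) C q
  c = 2 * suc k * (2 * suc k ∸ 1)
  -- j² is unfolded for the solver
  factor : ∀ A j p c B → A * (p * (j * (j * 1))) + c * (B * p) ≡ (A * (j * j) + c * B) * p
  factor = solve-∀

calS-recurrenceℕ : ∀ k m →
  calS (suc k) (m + 2) + 2 * suc k * (2 * suc k ∸ 1) * calS k m ≡ suc k ^ 2 * calS (suc k) m
calS-recurrenceℕ k m =
  sumBelow-combine k (suc k ^ 2) (2 * suc k * (2 * suc k ∸ 1))
    (summand (suc k) (m + 2)) (summand k m) (summand (suc k) m)
    (power-shift ((2 * suc k) C 0) (suc k) m) (termwise k m)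

+-moveʳ : ∀ a b c → a + c ≡ b → + a ≡ + b - + c
+-moveʳ a .(a + c) c refl = sym (begin
  + (a + c) - + c    ≡⟨ ℤP.[+m]-[+n]≡m⊖n (a + c) c ⟩
  (a + c) ⊖ c        ≡⟨ ℤP.⊖-≥ (m≤n+m c a) ⟩
  + (a + c ∸ c)      ≡⟨ cong +_ (m+n∸n≡m a c) ⟩
  + a                ∎)

mainTheorem5 : (k m : ℕ) →
    (+ calS (suc k) (m + 2)) ≡
      ((+ ((suc k) ^ 2 * calS (suc k) m))
        - (+ (2 * suc k * (2 * suc k ∸ 1) * calS k m)))
mainTheorem5 k m = +-moveʳ _ _ _ (calS-recurrenceℕ k m)
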